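{- Let $3 \le p \le q$ and let $D$ be a strong orientation of $K(3,p,q)$ with diameter two, with parts $V_1=\{x_1,x_2,x_3\}$, $V_2$ ($|V_2|=p$), $V_3$ ($|V_3|=q$). If $V_2 = V_2^A \cup V_2^B$ for two nonempty proper subsets $A$ and $B$ of $[3]=\{1,2,3\}$ with $|A| = |B|$, then $$q \le \max\left\{2 + \binom{p-1}{\lfloor \frac{p-1}{2} \rfloor} + \binom{p}{\lfloor \frac{p}{2} \rfloor},\ 1 + 2\binom{p-2}{\lfloor \frac{p-2}{2} \rfloor} + \binom{p}{\lfloor \frac{p}{2} \rfloor}\right\}.$$
   Context: $K(3,p,q)$ is the complete tripartite graph with parts $V_1=\{x_1,x_2,x_3\}$, $V_2$ of size $p$, $V_3$ of size $q$. A strong orientation is an orientation of all edges making the digraph strongly connected; its diameter is the maximum directed distance between ordered pairs of vertices. Write $u\to v$ if the edge $uv$ is oriented from $u$ to $v$. For $A \subseteq [3]$, let $N_D^A$ be the set of vertices $w$ such that $x_i \to w$ for all $i \in A$ and $w \to x_j$ for all $j \in [3]\setminus A$, and $V_2^A = V_2 \cap N_D^A$. -}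

module Defs where

open import Data.Nat using (ℕ)
open import Data.Bool using (Bool; true; false; T; not)
open import Data.Fin using (Fin)
open import Data.Fin.Subset using (Subset; _∈_; _∉_)
open import Data.Sum using (_⊎_; inj₁; inj₂)
open import Data.Product using (Σ; _×_; ∃; ∃-syntax)
open import Data.Empty using (⊥)
open import Relation.Binary.PropositionalEquality using (_≡_; _≢_)
open import Relation.Nullary using (¬_)

-- Vertex set of K(3,p,q):  inj₁ i = x_i ∈ V₁ (i : Fin 3),
-- inj₂ (inj₁ y) = y ∈ V₂ (|V₂| = p),  inj₂ (inj₂ z) = z ∈ V₃ (|V₃| = q).
Vertex : ℕ → ℕ → Set
Vertex p q = Fin 3 ⊎ (Fin p ⊎ Fin q)

x : ∀ {p q} → Fin 3 → Vertex p q
x i = inj₁ i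

v₂ : ∀ {p q} → Fin p → Vertex p q
v₂ y = inj₂ (inj₁ y)

v₃ : ∀ {p q} → Fin q → Vertex p q
v₃ z = inj₂ (inj₂ z)

-- An orientation of K(3,p,q): every edge between distinct parts gets a
-- direction.  o12 i y = true means x_i → y, false means y → x_i; etc.
record Orientation (p q : ℕ) : Set where
  field
    o12 : Fin 3 → Fin p → Bool
    o13 : Fin 3 → Fin q → Bool
    o23 : Fin p → Fin q → Bool

Arc : ∀ {p q} → Orientation p q → Vertex p q → Vertex p q → Set
Arc D (inj₁ i) (inj₁ j) = ⊥
Arc D (inj₁ i) (inj₂ (inj₁ y)) = T (Orientation.o12 D i y)
Arc D (inj₁ i) (inj₂ (inj₂ z)) = T (Orientation.o13 D i z)
Arc D (inj₂ (inj₁ y)) (inj₁ i) = T (not (Orientation.o12 D i y))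
Arc D (inj₂ (inj₁ y)) (inj₂ (inj₁ y')) = ⊥
Arc D (inj₂ (inj₁ y)) (inj₂ (inj₂ z)) = T (Orientation.o23 D y z)
Arc D (inj₂ (inj₂ z)) (inj₁ i) = T (not (Orientation.o13 D i z))
Arc D (inj₂ (inj₂ z)) (inj₂ (inj₁ y)) = T (not (Orientation.o23 D y z))
Arc D (inj₂ (inj₂ z)) (inj₂ (inj₂ z')) = ⊥

DistLe2 : ∀ {p q} → Orientation p q → Vertex p q → Vertex p q → Set
DistLe2 D u v = u ≡ v ⊎ (Arc D u v ⊎ ∃[ w ] (Arc D u w × Arc D w v))

-- D is a strong orientation of diameter two: all directed distances are
-- at most 2 (which in particular makes D strongly connected), and some
-- ordered pair has distance exactly 2 (i.e. not at most 1).
StrongDiameterTwo : ∀ {p q} → Orientation p q → Set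
StrongDiameterTwo {p} {q} D =
  (∀ u v → DistLe2 D u v) ×
  ∃[ u ] ∃[ v ] (u ≢ v × ¬ Arc D u v)

InN : ∀ {p q} → Orientation p q → Subset 3 → Vertex p q → Set
InN D A w = ∀ (i : Fin 3) → (i ∈ A → Arc D (x i) w) × (i ∉ A → Arc D w (x i))

InV2 : ∀ {p q} → Orientation p q → Subset 3 → Fin p → Set
InV2 D A y = InN D A (v₂ y)

-- The proof uses only that all distances in D are at most two, and neither 3 ≤ p nor p ≤ q; it
-- yields q ≤ 2 + C(p ∸ 1) + C(p), the first term of the maximum, where C(n) = n C ⌊ n /2⌋.
--
-- Reversing every arc exchanges V₂^{∁A} and V₂^{A} and keeps the diameter, so we may assume A = {i}
-- and B = {j}. Every y ∈ V₂ then has exactly one in-neighbour in V₁, x_i or x_j, so the third vertex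
-- of V₁ has no out-neighbour in V₂ and hence dominates V₃. Classify z ∈ V₃ by its arcs to x_i and x_j;
-- two members z ≠ z′ of a class are twins over V₁, so the path z → y → z′ passes through V₂ and the
-- path z′ → x_l → y back to y through V₁. Thus y lies in the set R of V₂-vertices reachable from the
-- class through V₁, and the sets N⁺(z) ∩ R of a class form an antichain: by Sperner's theorem (via
-- the LYM inequality) the class has at most C(|R|) members. With a = |N⁺(x_i) ∩ V₂| and b = p ∸ a the
-- four classes have at most 1, C(a), C(b), C(p) members, and the last three are empty unless a ≥ 2,
-- b ≥ 2, resp. a, b ≥ 1. Finally C(n) + C(n + 1) ≤ C(n + 2) gives C(a) + C(b) ≤ 1 + C(p ∸ 1) when
-- a, b ≥ 2.

{-# OPTIONS --safe #-}
module Submission where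

open import Defs
open import Data.Nat using (ℕ; _≤_; _⊔_; _+_; _*_; _∸_; ⌊_/2⌋)
open import Data.Nat.Combinatorics using (_C_)
open import Data.Fin using (Fin)
open import Data.Fin.Subset using (Subset; Nonempty; ⊤; ∣_∣)
open import Data.Sum using (_⊎_)
open import Relation.Binary.PropositionalEquality using (_≡_; _≢_)

open import Level using (Level)
open import Data.Nat using (zero; suc; NonZero; _≤′_; ≤′-refl; ≤′-step; z≤n; s≤s; _!; ⌈_/2⌉)
open import Data.Nat.Properties
open import Data.Nat.Combinatorics
  using (nCk≡n!/k![n-k]!; k![n∸k]!∣n!; [n-k]*d[k+1]≡[k+1]*d[k]; nCk+nC[k+1]≡[n+1]C[k+1])
open import Data.Nat.DivMod using (m/n*n≡m)
open import Data.Nat.Divisibility using (∣⇒≤)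
open import Data.Nat.ListAction using () renaming (sum to sumᴸ)
open import Algebra.Properties.Semiring.Sum +-*-semiring
  using (sum; sum-remove; ∑-distrib-+; sum-replicate-zero; sum-cong-≗; *-distribʳ-sum)
open import Data.Bool as Bool using (Bool; true; false; not; T; T?; _∧_; _∨_)
open import Data.Bool.Properties using (T-∧; T-∨; T-≡; T-not-≡; ∨-identityʳ)
open import Data.Fin using (zero; suc; punchIn; punchOut)
import Data.Fin.Properties as Fin
open import Data.Fin.Properties using (punchIn-punchOut)
open import Data.Fin.Subset using (⁅_⁆; _∈_; ∁)
open import Data.Fin.Subset.Properties
  using (_∈?_; x∈⁅x⁆; x∈⁅y⁆⇒x≡y; x≢y⇒x∉⁅y⁆; x∈p⇒x∉∁p; x∉p⇒x∈∁p; ∉⊥; ∣⁅x⁆∣≡1; ∣∁p∣≡n∸∣p∣)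
open import Data.Vec using ([]; _∷_)
open import Data.Vec.Functional using (Vector; removeAt)
open import Data.List as List using (List; []; _∷_; length; filter; allFin)
open import Data.List.Properties using (map-cong-local; filter-none; length-map; length-tabulate)
open import Data.List.Relation.Unary.All as All using (All; []; _∷_)
import Data.List.Relation.Unary.All.Properties as Allₚ
open import Data.List.Relation.Unary.AllPairs as AllPairs using (AllPairs; []; _∷_)
import Data.List.Relation.Unary.AllPairs.Properties as AllPairsₚ
open import Data.List.Relation.Unary.Unique.Propositional using (Unique)
open import Data.List.Relation.Unary.Unique.Propositional.Properties using (allFin⁺)
open import Data.Product using (∃; ∃-syntax; _×_; _,_; proj₁; proj₂)
open import Data.Sum as Sum using (inj₁; inj₂; [_,_]′)
open import Data.Empty using (⊥-elim)
open import Data.Unit using (tt)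
open import Function using (_∘_; id)
open import Function.Bundles using (Equivalence)
open import Relation.Binary.PropositionalEquality
  using (refl; sym; trans; cong; cong₂; subst; module ≡-Reasoning)
open import Relation.Nullary using (¬_; Dec; yes; no)

private variable
  a ℓ : Level
  A : Set a
  n : ℕ

AllPairs-restrict : {P : A → Set ℓ} {R : A → A → Set ℓ} {xs : List A} →
                    All P xs → AllPairs (λ x y → P x → P y → R x y) xs → AllPairs R xs
AllPairs-restrict []         []         = []
AllPairs-restrict (px ∷ pxs) (rx ∷ rxs) =
  All.zipWith (λ (r , py) → r px py) (rx , pxs) ∷ AllPairs-restrict pxs rxs

length-filter-split : (f : A → Bool) (xs : List A) →
  length xs ≡ length (filter (λ x → f x Bool.≟ true) xs) + length (filter (λ x → f x Bool.≟ false) xs)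
length-filter-split f []       = refl
length-filter-split f (x ∷ xs) with f x
... | true  = cong suc (length-filter-split f xs)
... | false = trans (cong suc (length-filter-split f xs)) (sym (+-suc _ _))

empty-or-member : {P : A → Set ℓ} {xs : List A} → All P xs → length xs ≡ 0 ⊎ ∃ P
empty-or-member []       = inj₁ refl
empty-or-member (px ∷ _) = inj₂ (_ , px)

-- Finite sets as characteristic vectors

𝟙 : Bool → ℕ
𝟙 true  = 1
𝟙 false = 0

𝟙-T : ∀ {b} → T b → 𝟙 b ≡ 1
𝟙-T {true} _ = refl

card : Vector Bool n → ℕ
card S = sum (𝟙 ∘ S)

_⊆_ : Vector Bool n → Vector Bool n → Set
S ⊆ R = ∀ k → T (S k) → T (R k)

_⊈_ : Vector Bool n → Vector Bool n → Set
S ⊈ R = ∃[ k ] (T (S k) × ¬ T (R k))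

Incomparable : Vector Bool n → Vector Bool n → Set
Incomparable S R = S ⊈ R × R ⊈ S

Antichain : List (Vector Bool n) → Set
Antichain = AllPairs Incomparable

sum-mono-≤ : {f g : Vector ℕ n} → (∀ k → f k ≤ g k) → sum f ≤ sum g
sum-mono-≤ {zero}  _   = z≤n
sum-mono-≤ {suc n} f≤g = +-mono-≤ (f≤g zero) (sum-mono-≤ (f≤g ∘ suc))

card-removeAt : (S : Vector Bool (suc n)) {i : Fin (suc n)} → T (S i) →
                card S ≡ suc (card (removeAt S i))
card-removeAt S {i} i∈S = trans (sum-remove (𝟙 ∘ S)) (cong (_+ card (removeAt S i)) (𝟙-T i∈S))

card-mono : {S R : Vector Bool n} → S ⊆ R → card S ≤ card R
card-mono {S = S} {R} S⊆R = sum-mono-≤ λ k → 𝟙-mono (S k) (R k) (S⊆R k)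
  where
  𝟙-mono : ∀ b c → (T b → T c) → 𝟙 b ≤ 𝟙 c
  𝟙-mono false _ _   = z≤n
  𝟙-mono true  c b⇒c = ≤-reflexive (sym (𝟙-T (b⇒c tt)))

card+card-not : (S : Vector Bool n) → card S + card (not ∘ S) ≡ n
card+card-not {zero}  S = refl
card+card-not {suc n} S with S zero
... | true  = cong suc (card+card-not (S ∘ suc))
... | false = trans (+-suc _ _) (cong suc (card+card-not (S ∘ suc)))

card≤n : (S : Vector Bool n) → card S ≤ n
card≤n S = subst (card S ≤_) (card+card-not S) (m≤m+n _ _)

1≤card : (S : Vector Bool n) {y : Fin n} → T (S y) → 1 ≤ card S
1≤card {suc n} S y∈S rewrite card-removeAt S y∈S = s≤s z≤n

2≤card : (S : Vector Bool n) {y y′ : Fin n} → y ≢ y′ → T (S y) → T (S y′) → 2 ≤ card S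
2≤card {suc n} S {y} y≢y′ y∈S y′∈S rewrite card-removeAt S y∈S =
  s≤s (1≤card (removeAt S y) (subst (T ∘ S) (sym (punchIn-punchOut y≢y′)) y′∈S))

-- The LYM inequality and Sperner's theorem

-- k ! * (r ∸ k) ! = r ! / (r C k), so multiplying the LYM inequality ∑ 1 / (r C ∣S∣) ≤ 1 by r !
-- turns it into lymSum r 𝒮 ≤ r !.
lymWeight : ℕ → ℕ → ℕ
lymWeight r k = k ! * (r ∸ k) !

lymWeight-step : ∀ {r k} → suc k ≤ r ∸ k → lymWeight r (suc k) ≤ lymWeight r k
lymWeight-step {r} {k} 1+k≤r∸k = *-cancelˡ-≤ (suc k) (begin
  suc k * lymWeight r (suc k)    ≤⟨ *-monoˡ-≤ (lymWeight r (suc k)) 1+k≤r∸k ⟩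
  (r ∸ k) * lymWeight r (suc k)  ≡⟨ [n-k]*d[k+1]≡[k+1]*d[k] (≤-trans 1+k≤r∸k (m∸n≤m r k)) ⟩
  suc k * lymWeight r k          ∎)
  where open ≤-Reasoning

lymWeight-sym : ∀ {r k} → k ≤ r → lymWeight r (r ∸ k) ≡ lymWeight r k
lymWeight-sym {r} {k} k≤r =
  trans (cong (λ m → (r ∸ k) ! * m !) (m∸[m∸n]≡n k≤r)) (*-comm ((r ∸ k) !) (k !))

lymWeight-antitone : ∀ {r k j} → k ≤′ j → j ≤ ⌊ r /2⌋ → lymWeight r j ≤ lymWeight r k
lymWeight-antitone ≤′-refl _ = ≤-refl
lymWeight-antitone {r} {j = suc j} (≤′-step k≤′j) 1+j≤⌊r/2⌋ =
  ≤-trans (lymWeight-step 1+j≤r∸j) (lymWeight-antitone k≤′j (<⇒≤ 1+j≤⌊r/2⌋))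
  where
  open ≤-Reasoning
  1+j≤r∸j : suc j ≤ r ∸ j
  1+j≤r∸j = m+n≤o⇒m≤o∸n (suc j) (begin
    suc j + j          ≤⟨ +-mono-≤ 1+j≤⌊r/2⌋ (≤-trans (<⇒≤ 1+j≤⌊r/2⌋) (⌊n/2⌋≤⌈n/2⌉ r)) ⟩
    ⌊ r /2⌋ + ⌈ r /2⌉  ≡⟨ ⌊n/2⌋+⌈n/2⌉≡n r ⟩
    r                  ∎)

⌈n/2⌉≤1+⌊n/2⌋ : ∀ n → ⌈ n /2⌉ ≤ suc ⌊ n /2⌋
⌈n/2⌉≤1+⌊n/2⌋ zero          = z≤n
⌈n/2⌉≤1+⌊n/2⌋ (suc zero)    = s≤s z≤n
⌈n/2⌉≤1+⌊n/2⌋ (suc (suc n)) = s≤s (⌈n/2⌉≤1+⌊n/2⌋ n)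

lymWeight-min : ∀ {r k} → k ≤ r → lymWeight r ⌊ r /2⌋ ≤ lymWeight r k
lymWeight-min {r} {k} k≤r with k ≤? ⌊ r /2⌋
... | yes k≤⌊r/2⌋ = lymWeight-antitone (≤⇒≤′ k≤⌊r/2⌋) ≤-refl
... | no  k≰⌊r/2⌋ = begin
  lymWeight r ⌊ r /2⌋  ≤⟨ lymWeight-antitone (≤⇒≤′ r∸k≤⌊r/2⌋) ≤-refl ⟩
  lymWeight r (r ∸ k)  ≡⟨ lymWeight-sym k≤r ⟩
  lymWeight r k        ∎
  where
  open ≤-Reasoning
  r∸k≤⌊r/2⌋ : r ∸ k ≤ ⌊ r /2⌋
  r∸k≤⌊r/2⌋ = m≤n+o⇒m∸n≤o r k (begin
    r                  ≡⟨ ⌊n/2⌋+⌈n/2⌉≡n r ⟨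
    ⌊ r /2⌋ + ⌈ r /2⌉  ≤⟨ +-monoʳ-≤ ⌊ r /2⌋ (≤-trans (⌈n/2⌉≤1+⌊n/2⌋ r) (≰⇒> k≰⌊r/2⌋)) ⟩
    ⌊ r /2⌋ + k        ≡⟨ +-comm ⌊ r /2⌋ k ⟩
    k + ⌊ r /2⌋        ∎)

lymSum : ℕ → List (Vector Bool n) → ℕ
lymSum r 𝒮 = sumᴸ (List.map (lymWeight r ∘ card) 𝒮)

link : Fin (suc n) → List (Vector Bool (suc n)) → List (Vector Bool n)
link i 𝒮 = List.map (λ S → removeAt S i) (filter (λ S → T? (S i)) 𝒮)

sumᴸ-∑-comm : (f : A → Vector ℕ n) (xs : List A) →
              sumᴸ (List.map (sum ∘ f) xs) ≡ sum (λ i → sumᴸ (List.map (λ x → f x i) xs))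
sumᴸ-∑-comm {n = n} f []       = sym (sum-replicate-zero n)
sumᴸ-∑-comm         f (x ∷ xs) =
  trans (cong (sum (f x) +_) (sumᴸ-∑-comm f xs)) (sym (∑-distrib-+ (f x) _))

𝟙-*-cong : ∀ b {x y} → (T b → x ≡ y) → 𝟙 b * x ≡ 𝟙 b * y
𝟙-*-cong true  x≡y = cong (1 *_) (x≡y tt)
𝟙-*-cong false _   = refl

lymWeight-suc≡∑-removeAt : ∀ r (S : Vector Bool (suc n)) {k} → T (S k) →
  sum (λ i → 𝟙 (S i) * lymWeight r (card (removeAt S i))) ≡ lymWeight (suc r) (card S)
lymWeight-suc≡∑-removeAt r S {k} k∈S = begin
  sum (λ i → 𝟙 (S i) * lymWeight r (card (removeAt S i)))
    ≡⟨ sum-cong-≗ (λ i → 𝟙-*-cong (S i) (cong (lymWeight r) ∘ card-removeAt≡c)) ⟩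
  sum (λ i → 𝟙 (S i) * lymWeight r c)   ≡⟨ *-distribʳ-sum (lymWeight r c) (𝟙 ∘ S) ⟨
  card S * lymWeight r c                ≡⟨ cong (_* lymWeight r c) ∣S∣≡1+c ⟩
  suc c * lymWeight r c                 ≡⟨ *-assoc (suc c) (c !) ((r ∸ c) !) ⟨
  lymWeight (suc r) (suc c)             ≡⟨ cong (lymWeight (suc r)) ∣S∣≡1+c ⟨
  lymWeight (suc r) (card S)            ∎
  where
  open ≡-Reasoning
  c = card (removeAt S k)
  ∣S∣≡1+c = card-removeAt S k∈S
  card-removeAt≡c : ∀ {i} → T (S i) → card (removeAt S i) ≡ c
  card-removeAt≡c i∈S = suc-injective (trans (sym (card-removeAt S i∈S)) ∣S∣≡1+c)

lymSum-link : ∀ r i (𝒮 : List (Vector Bool (suc n))) →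
  lymSum r (link i 𝒮) ≡ sumᴸ (List.map (λ S → 𝟙 (S i) * lymWeight r (card (removeAt S i))) 𝒮)
lymSum-link r i []      = refl
lymSum-link r i (S ∷ 𝒮) with S i
... | true  = cong₂ _+_ (sym (+-identityʳ _)) (lymSum-link r i 𝒮)
... | false = lymSum-link r i 𝒮

⊈-removeAt : {S R : Vector Bool (suc n)} {i : Fin (suc n)} →
             T (R i) → S ⊈ R → removeAt S i ⊈ removeAt R i
⊈-removeAt {S = S} {R} {i} i∈R (k , k∈S , k∉R) =
  punchOut i≢k ,
  subst (T ∘ S) (sym (punchIn-punchOut i≢k)) k∈S ,
  k∉R ∘ subst (T ∘ R) (punchIn-punchOut i≢k)
  where
  i≢k : i ≢ k
  i≢k refl = k∉R i∈R

module _ {i : Fin (suc n)} {𝒮 : List (Vector Bool (suc n))} where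

  link-⊆ : {R : Vector Bool (suc n)} → All (_⊆ R) 𝒮 → All (_⊆ removeAt R i) (link i 𝒮)
  link-⊆ ⊆R = Allₚ.map⁺ (All.map (λ S⊆R k → S⊆R (punchIn i k)) (Allₚ.filter⁺ (λ S → T? (S i)) ⊆R))

  link-antichain : Antichain 𝒮 → Antichain (link i 𝒮)
  link-antichain anti =
    AllPairsₚ.map⁺ (AllPairs-restrict (Allₚ.all-filter (λ S → T? (S i)) 𝒮)
      (AllPairsₚ.filter⁺ (λ S → T? (S i))
        (AllPairs.map (λ (S⊈S′ , S′⊈S) i∈S i∈S′ → ⊈-removeAt i∈S′ S⊈S′ , ⊈-removeAt i∈S S′⊈S) anti)))

  link-∉ : {R : Vector Bool (suc n)} → ¬ T (R i) → All (_⊆ R) 𝒮 → link i 𝒮 ≡ []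
  link-∉ i∉R ⊆R =
    cong (List.map _) (filter-none (λ S → T? (S i)) (All.map (λ S⊆R i∈S → i∉R (S⊆R i i∈S)) ⊆R))

antichain-nonempty : {S S′ : Vector Bool n} {𝒮 : List (Vector Bool n)} →
                     Antichain (S ∷ S′ ∷ 𝒮) → All (λ S → ∃[ k ] T (S k)) (S ∷ S′ ∷ 𝒮)
antichain-nonempty (S-incs@(((k , k∈S , _) , _) ∷ _) ∷ _) =
  (k , k∈S) ∷ All.map (λ (_ , (k , k∈S′ , _)) → k , k∈S′) S-incs

-- The inductive step sums lymWeight-suc≡∑-removeAt over 𝒮, which needs nonempty members; only an
-- antichain with at least two members guarantees that, so a single set is treated on its own.
lym : (R : Vector Bool n) (𝒮 : List (Vector Bool n)) → All (_⊆ R) 𝒮 → Antichain 𝒮 →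
      lymSum (card R) 𝒮 ≤ card R !
lym R []       _ _ = z≤n
lym R (_ ∷ []) (S⊆R ∷ []) _ =
  ≤-trans (≤-reflexive (+-identityʳ _)) (∣⇒≤ {{card R !≢0}} (k![n∸k]!∣n! (card-mono S⊆R)))
lym {zero}  R (_ ∷ _ ∷ _) _ ((((() , _) , _) ∷ _) ∷ _)
lym {suc n} R 𝒮@(_ ∷ _ ∷ _) ⊆R@(S⊆R ∷ _) anti with antichain-nonempty anti
... | nonempty@((k , k∈S) ∷ _) = begin
  lymSum (card R) 𝒮
    ≡⟨ cong (λ m → lymSum m 𝒮) ∣R∣≡1+r ⟩
  lymSum (suc r) 𝒮
    ≡⟨ cong sumᴸ (map-cong-local (All.map (λ {S} (_ , k∈S) → sym (lymWeight-suc≡∑-removeAt r S k∈S))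
                                          nonempty)) ⟩
  sumᴸ (List.map (λ S → sum (λ i → w S i)) 𝒮)
    ≡⟨ sumᴸ-∑-comm w 𝒮 ⟩
  sum (λ i → sumᴸ (List.map (λ S → w S i) 𝒮))
    ≡⟨ sum-cong-≗ (λ i → lymSum-link r i 𝒮) ⟨
  sum (λ i → lymSum r (link i 𝒮))
    ≤⟨ sum-mono-≤ link-bound ⟩
  sum (λ i → 𝟙 (R i) * r !)    ≡⟨ *-distribʳ-sum (r !) (𝟙 ∘ R) ⟨
  card R * r !                 ≡⟨ cong (_* r !) ∣R∣≡1+r ⟩
  suc r !                      ≡⟨ cong _! ∣R∣≡1+r ⟨
  card R !                     ∎
  where
  open ≤-Reasoning
  r = card (removeAt R k)
  ∣R∣≡1+r = card-removeAt R (S⊆R k k∈S)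
  w : Vector Bool (suc n) → Fin (suc n) → ℕ
  w S i = 𝟙 (S i) * lymWeight r (card (removeAt S i))
  link-bound : ∀ i → lymSum r (link i 𝒮) ≤ 𝟙 (R i) * r !
  link-bound i with T? (R i)
  ... | no  i∉R = subst (λ 𝒯 → lymSum r 𝒯 ≤ _) (sym (link-∉ i∉R ⊆R)) z≤n
  ... | yes i∈R = begin
    lymSum r (link i 𝒮)
      ≤⟨ subst (λ m → lymSum m (link i 𝒮) ≤ m !) ∣R-i∣≡r
               (lym (removeAt R i) (link i 𝒮) (link-⊆ ⊆R) (link-antichain anti)) ⟩
    r !            ≡⟨ *-identityˡ (r !) ⟨
    1 * r !        ≡⟨ cong (_* r !) (𝟙-T i∈R) ⟨
    𝟙 (R i) * r !  ∎
    where
    ∣R-i∣≡r : card (removeAt R i) ≡ r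
    ∣R-i∣≡r = suc-injective (trans (sym (card-removeAt R i∈R)) ∣R∣≡1+r)

midBinom : ℕ → ℕ
midBinom r = r C ⌊ r /2⌋

lymWeight-mid≢0 : ∀ r → NonZero (lymWeight r ⌊ r /2⌋)
lymWeight-mid≢0 r = ⌊ r /2⌋ !* (r ∸ ⌊ r /2⌋) !≢0

midBinom*lymWeight : ∀ r → midBinom r * lymWeight r ⌊ r /2⌋ ≡ r !
midBinom*lymWeight r =
  trans (cong (_* lymWeight r ⌊ r /2⌋) (nCk≡n!/k![n-k]! (⌊n/2⌋≤n r)))
        (m/n*n≡m {{lymWeight-mid≢0 r}} (k![n∸k]!∣n! (⌊n/2⌋≤n r)))

length*lymWeight≤lymSum : ∀ {r} {𝒮 : List (Vector Bool n)} → All (λ S → card S ≤ r) 𝒮 →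
                          length 𝒮 * lymWeight r ⌊ r /2⌋ ≤ lymSum r 𝒮
length*lymWeight≤lymSum []           = z≤n
length*lymWeight≤lymSum (∣S∣≤r ∷ ≤r) = +-mono-≤ (lymWeight-min ∣S∣≤r) (length*lymWeight≤lymSum ≤r)

sperner : (R : Vector Bool n) (𝒮 : List (Vector Bool n)) → All (_⊆ R) 𝒮 → Antichain 𝒮 →
          length 𝒮 ≤ midBinom (card R)
sperner R 𝒮 ⊆R anti = *-cancelʳ-≤ (length 𝒮) (midBinom r) _ {{lymWeight-mid≢0 r}} (begin
  length 𝒮 * lymWeight r ⌊ r /2⌋    ≤⟨ length*lymWeight≤lymSum (All.map card-mono ⊆R) ⟩
  lymSum r 𝒮                       ≤⟨ lym R 𝒮 ⊆R anti ⟩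
  r !                              ≡⟨ midBinom*lymWeight r ⟨
  midBinom r * lymWeight r ⌊ r /2⌋  ∎)
  where
  open ≤-Reasoning
  r = card R

C≤[1+n]C : ∀ n k → n C k ≤ suc n C k
C≤[1+n]C n zero    = ≤-refl
C≤[1+n]C n (suc k) = subst (n C suc k ≤_) (nCk+nC[k+1]≡[n+1]C[k+1] n k) (m≤n+m _ _)

C≤[1+n]C[1+k] : ∀ n k → n C k ≤ suc n C suc k
C≤[1+n]C[1+k] n k = subst (n C k ≤_) (nCk+nC[k+1]≡[n+1]C[k+1] n k) (m≤m+n _ _)

⌊1+n/2⌋≡⌊n/2⌋⊎1+⌊n/2⌋ : ∀ n → ⌊ suc n /2⌋ ≡ ⌊ n /2⌋ ⊎ ⌊ suc n /2⌋ ≡ suc ⌊ n /2⌋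
⌊1+n/2⌋≡⌊n/2⌋⊎1+⌊n/2⌋ zero          = inj₁ refl
⌊1+n/2⌋≡⌊n/2⌋⊎1+⌊n/2⌋ (suc zero)    = inj₂ refl
⌊1+n/2⌋≡⌊n/2⌋⊎1+⌊n/2⌋ (suc (suc n)) = Sum.map (cong suc) (cong suc) (⌊1+n/2⌋≡⌊n/2⌋⊎1+⌊n/2⌋ n)

midBinom≤midBinom[1+n] : ∀ n → midBinom n ≤ midBinom (suc n)
midBinom≤midBinom[1+n] n with ⌊ suc n /2⌋ | ⌊1+n/2⌋≡⌊n/2⌋⊎1+⌊n/2⌋ n
... | _ | inj₁ refl = C≤[1+n]C n ⌊ n /2⌋
... | _ | inj₂ refl = C≤[1+n]C[1+k] n ⌊ n /2⌋

midBinom-mono : ∀ {m n} → m ≤ n → midBinom m ≤ midBinom n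
midBinom-mono = go ∘ ≤⇒≤′
  where
  go : ∀ {m n} → m ≤′ n → midBinom m ≤ midBinom n
  go ≤′-refl                    = ≤-refl
  go {n = suc n} (≤′-step m≤′n) = ≤-trans (go m≤′n) (midBinom≤midBinom[1+n] n)

midBinom+midBinom[1+n]≤midBinom[2+n] : ∀ n → midBinom n + midBinom (suc n) ≤ midBinom (suc (suc n))
midBinom+midBinom[1+n]≤midBinom[2+n] n with ⌊ suc n /2⌋ | ⌊1+n/2⌋≡⌊n/2⌋⊎1+⌊n/2⌋ n
... | _ | inj₁ refl = begin
  n C m + suc n C m          ≡⟨ +-comm (n C m) _ ⟩
  suc n C m + n C m          ≤⟨ +-monoʳ-≤ (suc n C m) (C≤[1+n]C[1+k] n m) ⟩
  suc n C m + suc n C suc m  ≡⟨ nCk+nC[k+1]≡[n+1]C[k+1] (suc n) m ⟩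
  suc (suc n) C suc m        ∎
  where open ≤-Reasoning; m = ⌊ n /2⌋
... | _ | inj₂ refl = begin
  n C m + suc n C suc m      ≤⟨ +-monoˡ-≤ (suc n C suc m) (C≤[1+n]C n m) ⟩
  suc n C m + suc n C suc m  ≡⟨ nCk+nC[k+1]≡[n+1]C[k+1] (suc n) m ⟩
  suc (suc n) C suc m        ∎
  where open ≤-Reasoning; m = ⌊ n /2⌋

midBinom+midBinom≤midBinom[a+b∸1] : ∀ {a b} → 3 ≤ a → 2 ≤ b →
                                    midBinom a + midBinom b ≤ midBinom (a + b ∸ 1)
midBinom+midBinom≤midBinom[a+b∸1] {suc (suc (suc a))} {suc (suc b)} (s≤s (s≤s (s≤s _))) (s≤s (s≤s _)) =
  begin
  midBinom (3 + a) + midBinom (2 + b)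
    ≤⟨ +-mono-≤ (midBinom-mono 3+a≤1+c) (midBinom-mono (m≤n+m (2 + b) a)) ⟩
  midBinom (suc c) + midBinom c  ≡⟨ +-comm (midBinom (suc c)) _ ⟩
  midBinom c + midBinom (suc c)  ≤⟨ midBinom+midBinom[1+n]≤midBinom[2+n] c ⟩
  midBinom (2 + c)               ∎
  where
  open ≤-Reasoning
  c = a + (2 + b)
  3+a≤1+c : 3 + a ≤ suc c
  3+a≤1+c = s≤s (subst (2 + a ≤_) (+-comm (2 + b) a) (s≤s (s≤s (m≤n+m a b))))

midBinom+midBinom≤1+midBinom[a+b∸1] : ∀ {a b} → 2 ≤ a → 2 ≤ b →
                                      midBinom a + midBinom b ≤ suc (midBinom (a + b ∸ 1))
midBinom+midBinom≤1+midBinom[a+b∸1] {2} {2} (s≤s (s≤s _)) (s≤s (s≤s _)) = ≤-refl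
midBinom+midBinom≤1+midBinom[a+b∸1] {2} {b@(suc (suc (suc _)))} (s≤s (s≤s _)) (s≤s (s≤s _)) = begin
  midBinom 2 + midBinom b     ≡⟨ +-comm (midBinom 2) (midBinom b) ⟩
  midBinom b + midBinom 2     ≤⟨ midBinom+midBinom≤midBinom[a+b∸1] {b} {2} (s≤s (s≤s (s≤s z≤n))) ≤-refl ⟩
  midBinom (b + 2 ∸ 1)        ≡⟨ cong (λ t → midBinom (t ∸ 1)) (+-comm b 2) ⟩
  midBinom (2 + b ∸ 1)        ≤⟨ n≤1+n _ ⟩
  suc (midBinom (2 + b ∸ 1))  ∎
  where open ≤-Reasoning
midBinom+midBinom≤1+midBinom[a+b∸1] {2} {1} _ (s≤s ())
midBinom+midBinom≤1+midBinom[a+b∸1] {a@(suc (suc (suc _)))} (s≤s (s≤s _)) 2≤b =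
  m≤n⇒m≤1+n (midBinom+midBinom≤midBinom[a+b∸1] {a} (s≤s (s≤s (s≤s z≤n))) 2≤b)

class-sizes-bound : ∀ {a b p u v w} → a + b ≡ p →
  u ≤ midBinom a → u ≡ 0 ⊎ 2 ≤ a →
  v ≤ midBinom b → v ≡ 0 ⊎ 2 ≤ b →
  w ≤ midBinom p → w ≡ 0 ⊎ 1 ≤ a × 1 ≤ b →
  u + v + w ≤ suc (midBinom (p ∸ 1)) + midBinom p
class-sizes-bound {p = p} _ _ (inj₁ refl) _ (inj₁ refl) w≤ _ =
  ≤-trans w≤ (m≤n+m (midBinom p) _)
class-sizes-bound refl u≤ (inj₂ 2≤a) v≤ (inj₂ 2≤b) w≤ _ =
  +-mono-≤ (≤-trans (+-mono-≤ u≤ v≤) (midBinom+midBinom≤1+midBinom[a+b∸1] 2≤a 2≤b)) w≤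
class-sizes-bound {a} {b} {p} {u} refl u≤ (inj₂ _) _ (inj₁ refl) _ (inj₁ refl) = begin
  u + 0 + 0                            ≡⟨ cong (_+ 0) (+-identityʳ u) ⟩
  u + 0                                ≡⟨ +-identityʳ u ⟩
  u                                    ≤⟨ ≤-trans u≤ (midBinom-mono (m≤m+n a b)) ⟩
  midBinom p                           ≤⟨ m≤n+m (midBinom p) _ ⟩
  suc (midBinom (p ∸ 1)) + midBinom p  ∎
  where open ≤-Reasoning
class-sizes-bound {a} {_} {p} {u} {w = w} refl u≤ (inj₂ _) _ (inj₁ refl) w≤ (inj₂ (_ , 1≤b)) = begin
  u + 0 + w                            ≡⟨ cong (_+ w) (+-identityʳ u) ⟩
  u + w                                ≤⟨ +-mono-≤ (≤-trans u≤ (midBinom-mono a≤p∸1)) w≤ ⟩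
  midBinom (p ∸ 1) + midBinom p        ≤⟨ n≤1+n _ ⟩
  suc (midBinom (p ∸ 1)) + midBinom p  ∎
  where
  open ≤-Reasoning
  a≤p∸1 : a ≤ p ∸ 1
  a≤p∸1 = m+n≤o⇒m≤o∸n a (+-monoʳ-≤ a 1≤b)
class-sizes-bound {a} {b} {p} {v = v} refl _ (inj₁ refl) v≤ (inj₂ _) _ (inj₁ refl) = begin
  0 + v + 0                            ≡⟨ +-identityʳ v ⟩
  v                                    ≤⟨ ≤-trans v≤ (midBinom-mono (m≤n+m b a)) ⟩
  midBinom p                           ≤⟨ m≤n+m (midBinom p) _ ⟩
  suc (midBinom (p ∸ 1)) + midBinom p  ∎
  where open ≤-Reasoning
class-sizes-bound {a} {b} {p} {v = v} {w} refl _ (inj₁ refl) v≤ (inj₂ _) w≤ (inj₂ (1≤a , _)) = begin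
  0 + v + w                            ≤⟨ +-mono-≤ (≤-trans v≤ (midBinom-mono b≤p∸1)) w≤ ⟩
  midBinom (p ∸ 1) + midBinom p        ≤⟨ n≤1+n _ ⟩
  suc (midBinom (p ∸ 1)) + midBinom p  ∎
  where
  open ≤-Reasoning
  b≤p∸1 : b ≤ p ∸ 1
  b≤p∸1 = m+n≤o⇒m≤o∸n b (subst (b + 1 ≤_) (+-comm b a) (+-monoʳ-≤ b 1≤a))

-- Orientations of K(3,p,q) in which all distances are at most two

T⇒¬T-not : ∀ {b} → T b → ¬ T (not b)
T⇒¬T-not {true} _ ()

T-not⇒¬T : ∀ {b} → T (not b) → ¬ T b
T-not⇒¬T {false} _ ()

T-not-not : ∀ {b} → T b → T (not (not b))
T-not-not {true} _ = tt

module _ {p q : ℕ} (D : Orientation p q) where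
  open Orientation D

  Arc-asym : ∀ u v → Arc D u v → ¬ Arc D v u
  Arc-asym (inj₁ _)        (inj₁ _)        ()
  Arc-asym (inj₁ _)        (inj₂ (inj₁ _)) = T⇒¬T-not
  Arc-asym (inj₁ _)        (inj₂ (inj₂ _)) = T⇒¬T-not
  Arc-asym (inj₂ (inj₁ _)) (inj₁ _)        = T-not⇒¬T
  Arc-asym (inj₂ (inj₁ _)) (inj₂ (inj₁ _)) ()
  Arc-asym (inj₂ (inj₁ _)) (inj₂ (inj₂ _)) = T⇒¬T-not
  Arc-asym (inj₂ (inj₂ _)) (inj₁ _)        = T-not⇒¬T
  Arc-asym (inj₂ (inj₂ _)) (inj₂ (inj₁ _)) = T-not⇒¬T
  Arc-asym (inj₂ (inj₂ _)) (inj₂ (inj₂ _)) ()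

  DiameterAtMost2 : Set
  DiameterAtMost2 = ∀ u v → DistLe2 D u v

  ReachableViaV₁ : Fin q → Fin p → Set
  ReachableViaV₁ z y = ∃[ l ] (Arc D (v₃ z) (x l) × Arc D (x l) (v₂ y))

  Twins : Fin q → Fin q → Set
  Twins z z′ = ∀ l → o13 l z ≡ o13 l z′

  outNeighboursIn : Vector Bool p → Fin q → Vector Bool p
  outNeighboursIn R z y = not (o23 y z) ∧ R y

  InN-in-neighbour : ∀ {A w l} → InN D A w → Arc D (x l) w → l ∈ A
  InN-in-neighbour {A} {w} {l} w∈N l→w with l ∈? A
  ... | yes l∈A = l∈A
  ... | no  l∉A = ⊥-elim (Arc-asym (x l) w l→w (proj₂ (w∈N l) l∉A))

  other-singleton-type : ∀ {a c y} → InV2 D ⁅ a ⁆ y ⊎ InV2 D ⁅ c ⁆ y →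
                         Arc D (v₂ y) (x c) → Arc D (x a) (v₂ y)
  other-singleton-type {a}         (inj₁ y∈a) _   = proj₁ (y∈a a) (x∈⁅x⁆ a)
  other-singleton-type {c = c} {y} (inj₂ y∈c) y→c =
    ⊥-elim (Arc-asym (v₂ y) (x c) y→c (proj₁ (y∈c c) (x∈⁅x⁆ c)))

  module _ (diam : DiameterAtMost2) where

    in-path : ∀ {z l} → Arc D (v₃ z) (x l) → ∃[ y ] (Arc D (x l) (v₂ y) × Arc D (v₂ y) (v₃ z))
    in-path {z} {l} z→l with diam (x l) (v₃ z)
    ... | inj₁ ()
    ... | inj₂ (inj₁ l→z)                         = ⊥-elim (Arc-asym (v₃ z) (x l) z→l l→z)
    ... | inj₂ (inj₂ (inj₁ _ , () , _))
    ... | inj₂ (inj₂ (inj₂ (inj₁ y) , l→y , y→z)) = y , l→y , y→z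
    ... | inj₂ (inj₂ (inj₂ (inj₂ _) , _ , ()))

    out-path : ∀ {z l} → Arc D (x l) (v₃ z) → ∃[ y ] (Arc D (v₃ z) (v₂ y) × Arc D (v₂ y) (x l))
    out-path {z} {l} l→z with diam (v₃ z) (x l)
    ... | inj₁ ()
    ... | inj₂ (inj₁ z→l)                         = ⊥-elim (Arc-asym (x l) (v₃ z) l→z z→l)
    ... | inj₂ (inj₂ (inj₁ _ , _ , ()))
    ... | inj₂ (inj₂ (inj₂ (inj₁ y) , z→y , y→l)) = y , z→y , y→l
    ... | inj₂ (inj₂ (inj₂ (inj₂ _) , () , _))

    return-path : ∀ {y z} → Arc D (v₂ y) (v₃ z) → ReachableViaV₁ z y
    return-path {y} {z} y→z with diam (v₃ z) (v₂ y)
    ... | inj₁ ()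
    ... | inj₂ (inj₁ z→y)                   = ⊥-elim (Arc-asym (v₂ y) (v₃ z) y→z z→y)
    ... | inj₂ (inj₂ (inj₁ l , z→l , l→y))  = l , z→l , l→y
    ... | inj₂ (inj₂ (inj₂ (inj₁ _) , _ , ()))
    ... | inj₂ (inj₂ (inj₂ (inj₂ _) , () , _))

    twin-path : ∀ {z z′} → z ≢ z′ → Twins z z′ → ∃[ y ] (Arc D (v₃ z) (v₂ y) × Arc D (v₂ y) (v₃ z′))
    twin-path {z} {z′} z≢z′ twins with diam (v₃ z) (v₃ z′)
    ... | inj₁ refl                                = ⊥-elim (z≢z′ refl)
    ... | inj₂ (inj₁ ())
    ... | inj₂ (inj₂ (inj₁ l , z→l , l→z′))         =
      ⊥-elim (Arc-asym (v₃ z) (x l) z→l (subst T (sym (twins l)) l→z′))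
    ... | inj₂ (inj₂ (inj₂ (inj₁ y) , z→y , y→z′)) = y , z→y , y→z′
    ... | inj₂ (inj₂ (inj₂ (inj₂ _) , () , _))

    outNeighboursIn-⊈ : ∀ {R z z′} → z ≢ z′ → Twins z z′ → (∀ {y} → ReachableViaV₁ z′ y → T (R y)) →
                        outNeighboursIn R z ⊈ outNeighboursIn R z′
    outNeighboursIn-⊈ z≢z′ twins closed =
      let (y , z→y , y→z′) = twin-path z≢z′ twins in
      y , Equivalence.from T-∧ (z→y , closed (return-path y→z′)) ,
      λ y∈N⁺z′ → T⇒¬T-not y→z′ (proj₁ (Equivalence.to T-∧ y∈N⁺z′))

    1≤card-o12 : ∀ {z l} → Arc D (v₃ z) (x l) → 1 ≤ card (o12 l)
    1≤card-o12 {l = l} z→l = let (_ , l→y , _) = in-path z→l in 1≤card (o12 l) l→y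

    2≤card-o12 : ∀ {z l l′} → Arc D (v₃ z) (x l) → Arc D (x l′) (v₃ z) →
                 (∀ {y} → Arc D (v₂ y) (x l′) → Arc D (x l) (v₂ y)) → 2 ≤ card (o12 l)
    2≤card-o12 {z} {l} z→l l′→z l′-out⇒l-in with in-path z→l | out-path l′→z
    ... | y , l→y , y→z | y′ , z→y′ , y′→l′ = 2≤card (o12 l) y≢y′ l→y (l′-out⇒l-in y′→l′)
      where
      y≢y′ : y ≢ y′
      y≢y′ refl = Arc-asym (v₂ y) (v₃ z) y→z z→y′

    twin-class-bound : (R : Vector Bool p) (P : Fin q → Set) →
      (∀ {z z′} → P z → P z′ → Twins z z′) → (∀ {z y} → P z → ReachableViaV₁ z y → T (R y)) →
      {zs : List (Fin q)} → Unique zs → All P zs → length zs ≤ midBinom (card R)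
    twin-class-bound R _ twins closed {zs} unique Pzs =
      subst (_≤ midBinom (card R)) (length-map (outNeighboursIn R) zs)
        (sperner R (List.map (outNeighboursIn R) zs)
          (Allₚ.map⁺ (All.map (λ _ y y∈N⁺z → proj₂ (Equivalence.to T-∧ y∈N⁺z)) Pzs))
          (AllPairsₚ.map⁺ (AllPairs-restrict Pzs (AllPairs.map
            (λ z≢z′ Pz Pz′ → outNeighboursIn-⊈ z≢z′ (twins Pz Pz′) (closed Pz′) ,
                             outNeighboursIn-⊈ (z≢z′ ∘ sym) (twins Pz′ Pz) (closed Pz))
            unique))))

-- The case V₂ = V₂^{i} ∪ V₂^{j}

module _ {p q : ℕ} {D : Orientation p q} (diam : DiameterAtMost2 D) {i j : Fin 3} (i≢j : i ≢ j)
         (types : ∀ y → InV2 D ⁅ i ⁆ y ⊎ InV2 D ⁅ j ⁆ y) where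
  open Orientation D

  in-neighbour : ∀ {l y} → Arc D (x l) (v₂ y) → l ≡ i ⊎ l ≡ j
  in-neighbour {y = y} l→y with types y
  ... | inj₁ y∈i = inj₁ (x∈⁅y⁆⇒x≡y i (InN-in-neighbour D {⁅ i ⁆} {v₂ y} y∈i l→y))
  ... | inj₂ y∈j = inj₂ (x∈⁅y⁆⇒x≡y j (InN-in-neighbour D {⁅ j ⁆} {v₂ y} y∈j l→y))

  third-dominates : ∀ {l} → l ≢ i → l ≢ j → ∀ z → o13 l z ≡ true
  third-dominates {l} l≢i l≢j z with o13 l z in eq
  ... | true  = refl
  ... | false =
    let (_ , l→y , _) = in-path D diam (Equivalence.from T-not-≡ eq) in
    ⊥-elim ([ l≢i , l≢j ]′ (in-neighbour l→y))

  InClass : Bool → Bool → Fin q → Set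
  InClass b₁ b₂ z = o13 i z ≡ b₁ × o13 j z ≡ b₂

  class-twins : ∀ {b₁ b₂ z z′} → InClass b₁ b₂ z → InClass b₁ b₂ z′ → Twins D z z′
  class-twins (zi , zj) (z′i , z′j) l with l Fin.≟ i | l Fin.≟ j
  ... | yes refl | _        = trans zi (sym z′i)
  ... | no _     | yes refl = trans zj (sym z′j)
  ... | no l≢i   | no l≢j   = trans (third-dominates l≢i l≢j _) (sym (third-dominates l≢i l≢j _))

  -- not b₁ (not b₂) says that z → x_i (z → x_j) for the members z of class b₁ b₂.
  reachable : Bool → Bool → Vector Bool p
  reachable b₁ b₂ y = (not b₁ ∧ o12 i y) ∨ (not b₂ ∧ o12 j y)

  reachable-closed : ∀ {b₁ b₂ z y} → InClass b₁ b₂ z → ReachableViaV₁ D z y → T (reachable b₁ b₂ y)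
  reachable-closed (zi , zj) (_ , z→l , l→y) with in-neighbour l→y
  ... | inj₁ refl = Equivalence.from T-∨ (inj₁ (Equivalence.from T-∧ (subst (T ∘ not) zi z→l , l→y)))
  ... | inj₂ refl = Equivalence.from T-∨ (inj₂ (Equivalence.from T-∧ (subst (T ∘ not) zj z→l , l→y)))

  profile≟ : ∀ l b z → Dec (o13 l z ≡ b)
  profile≟ l b z = o13 l z Bool.≟ b

  class : Bool → Bool → List (Fin q)
  class b₁ b₂ = filter (profile≟ i b₁) (filter (profile≟ j b₂) (allFin q))

  class-members : ∀ b₁ b₂ → All (InClass b₁ b₂) (class b₁ b₂)
  class-members b₁ b₂ = All.zip
    ( Allₚ.all-filter (profile≟ i b₁) (filter (profile≟ j b₂) (allFin q))
    , Allₚ.filter⁺ (profile≟ i b₁) (Allₚ.all-filter (profile≟ j b₂) (allFin q)))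

  class-bound : ∀ b₁ b₂ → length (class b₁ b₂) ≤ midBinom (card (reachable b₁ b₂))
  class-bound b₁ b₂ =
    twin-class-bound D diam (reachable b₁ b₂) (InClass b₁ b₂) class-twins reachable-closed
      (AllPairsₚ.filter⁺ (profile≟ i b₁) (AllPairsₚ.filter⁺ (profile≟ j b₂) (allFin⁺ q)))
      (class-members b₁ b₂)

  q≡class-sizes : q ≡ (length (class true true) + length (class false true))
                    + (length (class true false) + length (class false false))
  q≡class-sizes = begin
    q                  ≡⟨ length-tabulate id ⟨
    length (allFin q)  ≡⟨ length-filter-split (λ z → o13 j z) (allFin q) ⟩
    length (filter (profile≟ j true) (allFin q)) + length (filter (profile≟ j false) (allFin q))
      ≡⟨ cong₂ _+_ (length-filter-split (λ z → o13 i z) (filter (profile≟ j true) (allFin q)))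
                   (length-filter-split (λ z → o13 i z) (filter (profile≟ j false) (allFin q))) ⟩
    (length (class true true) + length (class false true))
      + (length (class true false) + length (class false false)) ∎
    where open ≡-Reasoning

  o12-j≡not-o12-i : ∀ y → o12 j y ≡ not (o12 i y)
  o12-j≡not-o12-i y with types y
  ... | inj₁ y∈i = trans (Equivalence.to T-not-≡ (proj₂ (y∈i j) (x≢y⇒x∉⁅y⁆ (i≢j ∘ sym))))
                         (cong not (sym (Equivalence.to T-≡ (proj₁ (y∈i i) (x∈⁅x⁆ i)))))
  ... | inj₂ y∈j = trans (Equivalence.to T-≡ (proj₁ (y∈j j) (x∈⁅x⁆ j)))
                         (cong not (sym (Equivalence.to T-not-≡ (proj₂ (y∈j i) (x≢y⇒x∉⁅y⁆ i≢j)))))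

  card-o12-i+card-o12-j≡p : card (o12 i) + card (o12 j) ≡ p
  card-o12-i+card-o12-j≡p =
    trans (cong (card (o12 i) +_) (sum-cong-≗ (cong 𝟙 ∘ o12-j≡not-o12-i))) (card+card-not (o12 i))

  two-singleton-types-bound : q ≤ 2 + midBinom (p ∸ 1) + midBinom p
  two-singleton-types-bound = begin
    q                                  ≡⟨ q≡class-sizes ⟩
    (t + u) + (v + w)                  ≡⟨ +-assoc t u (v + w) ⟩
    t + (u + (v + w))                  ≡⟨ cong (t +_) (+-assoc u v w) ⟨
    t + (u + v + w)                    ≤⟨ +-mono-≤ t≤1 (class-sizes-bound card-o12-i+card-o12-j≡p
                                            u≤ u-nonempty v≤ v-nonempty w≤ w-nonempty) ⟩
    2 + midBinom (p ∸ 1) + midBinom p  ∎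
    where
    open ≤-Reasoning
    t = length (class true true)
    u = length (class false true)
    v = length (class true false)
    w = length (class false false)
    t≤1 : t ≤ 1
    t≤1 = subst (λ c → t ≤ midBinom c) (sum-replicate-zero p) (class-bound true true)
    u≤ : u ≤ midBinom (card (o12 i))
    u≤ = subst (λ c → u ≤ midBinom c) (sum-cong-≗ (cong 𝟙 ∘ ∨-identityʳ ∘ o12 i)) (class-bound false true)
    v≤ : v ≤ midBinom (card (o12 j))
    v≤ = class-bound true false
    w≤ : w ≤ midBinom p
    w≤ = ≤-trans (class-bound false false) (midBinom-mono (card≤n (reachable false false)))
    u-nonempty : u ≡ 0 ⊎ 2 ≤ card (o12 i)
    u-nonempty = Sum.map₂
      (λ (_ , zi , zj) → 2≤card-o12 D diam (Equivalence.from T-not-≡ zi) (Equivalence.from T-≡ zj)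
                                           (other-singleton-type D (types _)))
      (empty-or-member (class-members false true))
    v-nonempty : v ≡ 0 ⊎ 2 ≤ card (o12 j)
    v-nonempty = Sum.map₂
      (λ (_ , zi , zj) → 2≤card-o12 D diam (Equivalence.from T-not-≡ zj) (Equivalence.from T-≡ zi)
                                           (other-singleton-type D (Sum.swap (types _))))
      (empty-or-member (class-members true false))
    w-nonempty : w ≡ 0 ⊎ 1 ≤ card (o12 i) × 1 ≤ card (o12 j)
    w-nonempty = Sum.map₂
      (λ (_ , zi , zj) → 1≤card-o12 D diam (Equivalence.from T-not-≡ zi) ,
                         1≤card-o12 D diam (Equivalence.from T-not-≡ zj))
      (empty-or-member (class-members false false))

-- Reduction to two singleton types

reverse : ∀ {p q} → Orientation p q → Orientation p q
reverse D = record
  { o12 = λ i y → not (Orientation.o12 D i y)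
  ; o13 = λ i z → not (Orientation.o13 D i z)
  ; o23 = λ y z → not (Orientation.o23 D y z)
  }

module _ {p q : ℕ} (D : Orientation p q) where

  Arc-reverse : ∀ u v → Arc D v u → Arc (reverse D) u v
  Arc-reverse (inj₁ _)        (inj₁ _)        ()
  Arc-reverse (inj₁ _)        (inj₂ (inj₁ _)) = id
  Arc-reverse (inj₁ _)        (inj₂ (inj₂ _)) = id
  Arc-reverse (inj₂ (inj₁ _)) (inj₁ _)        = T-not-not
  Arc-reverse (inj₂ (inj₁ _)) (inj₂ (inj₁ _)) ()
  Arc-reverse (inj₂ (inj₁ _)) (inj₂ (inj₂ _)) = id
  Arc-reverse (inj₂ (inj₂ _)) (inj₁ _)        = T-not-not
  Arc-reverse (inj₂ (inj₂ _)) (inj₂ (inj₁ _)) = T-not-not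
  Arc-reverse (inj₂ (inj₂ _)) (inj₂ (inj₂ _)) ()

  reverse-diameter : DiameterAtMost2 D → DiameterAtMost2 (reverse D)
  reverse-diameter diam u v with diam v u
  ... | inj₁ v≡u                    = inj₁ (sym v≡u)
  ... | inj₂ (inj₁ v→u)             = inj₂ (inj₁ (Arc-reverse u v v→u))
  ... | inj₂ (inj₂ (w , v→w , w→u)) = inj₂ (inj₂ (w , Arc-reverse u w w→u , Arc-reverse w v v→w))

  InN-∁-reverse : ∀ {A w} → InN D (∁ A) w → InN (reverse D) A w
  InN-∁-reverse {w = w} w∈N l =
    (λ l∈A → Arc-reverse (x l) w (proj₂ (w∈N l) (x∈p⇒x∉∁p l∈A))) ,
    (λ l∉A → Arc-reverse w (x l) (proj₁ (w∈N l) (x∉p⇒x∈∁p l∉A)))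

singleton-or-cosingleton : (A : Subset 3) → Nonempty A → A ≢ ⊤ → ∃[ i ] (A ≡ ⁅ i ⁆ ⊎ A ≡ ∁ ⁅ i ⁆)
singleton-or-cosingleton (false ∷ false ∷ false ∷ []) (_ , k∈∅) _ = ⊥-elim (∉⊥ k∈∅)
singleton-or-cosingleton (true  ∷ false ∷ false ∷ []) _ _   = zero , inj₁ refl
singleton-or-cosingleton (false ∷ true  ∷ false ∷ []) _ _   = suc zero , inj₁ refl
singleton-or-cosingleton (false ∷ false ∷ true  ∷ []) _ _   = suc (suc zero) , inj₁ refl
singleton-or-cosingleton (false ∷ true  ∷ true  ∷ []) _ _   = zero , inj₂ refl
singleton-or-cosingleton (true  ∷ false ∷ true  ∷ []) _ _   = suc zero , inj₂ refl
singleton-or-cosingleton (true  ∷ true  ∷ false ∷ []) _ _   = suc (suc zero) , inj₂ refl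
singleton-or-cosingleton (true  ∷ true  ∷ true  ∷ []) _ A≢⊤ = ⊥-elim (A≢⊤ refl)

∣⁅i⁆∣≢∣∁⁅j⁆∣ : (i j : Fin 3) → ∣ ⁅ i ⁆ ∣ ≢ ∣ ∁ ⁅ j ⁆ ∣
∣⁅i⁆∣≢∣∁⁅j⁆∣ i j eq
  with trans (sym (∣⁅x⁆∣≡1 i)) (trans eq (trans (∣∁p∣≡n∸∣p∣ ⁅ j ⁆) (cong (3 ∸_) (∣⁅x⁆∣≡1 j))))
... | ()

lemma4p5 : (p q : ℕ) → 3 ≤ p → p ≤ q →
    (D : Orientation p q) → StrongDiameterTwo D →
    (A B : Subset 3) →
    Nonempty A → A ≢ ⊤ → Nonempty B → B ≢ ⊤ → A ≢ B → ∣ A ∣ ≡ ∣ B ∣ →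
    (∀ (y : Fin p) → InV2 D A y ⊎ InV2 D B y) →
    q ≤ ((2 + ((p ∸ 1) C ⌊ (p ∸ 1) /2⌋) + (p C ⌊ p /2⌋))
        ⊔ (1 + 2 * ((p ∸ 2) C ⌊ (p ∸ 2) /2⌋) + (p C ⌊ p /2⌋)))
lemma4p5 p q _ _ D (diam , _) A B A≢∅ A≢⊤ B≢∅ B≢⊤ A≢B ∣A∣≡∣B∣ V₂⊆A∪B =
  ≤-trans bound (m≤m⊔n _ (1 + 2 * midBinom (p ∸ 2) + midBinom p))
  where
  bound : q ≤ 2 + midBinom (p ∸ 1) + midBinom p
  bound with singleton-or-cosingleton A A≢∅ A≢⊤ | singleton-or-cosingleton B B≢∅ B≢⊤
  ... | i , inj₁ refl | j , inj₁ refl = two-singleton-types-bound diam (A≢B ∘ cong ⁅_⁆) V₂⊆A∪B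
  ... | i , inj₂ refl | j , inj₂ refl =
    two-singleton-types-bound (reverse-diameter D diam) (A≢B ∘ cong (∁ ∘ ⁅_⁆))
      (λ y → Sum.map (InN-∁-reverse D {⁅ i ⁆} {v₂ y}) (InN-∁-reverse D {⁅ j ⁆} {v₂ y}) (V₂⊆A∪B y))
  ... | i , inj₁ refl | j , inj₂ refl = ⊥-elim (∣⁅i⁆∣≢∣∁⁅j⁆∣ i j ∣A∣≡∣B∣)
  ... | i , inj₂ refl | j , inj₁ refl = ⊥-elim (∣⁅i⁆∣≢∣∁⁅j⁆∣ j i (sym ∣A∣≡∣B∣))
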